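{- Every substitutional pre-family of logics $\mathbf L=\langle\mathcal L^P:P\in\mathrm{Sig}\rangle$ is a logic family; moreover it satisfies the stronger condition (4b): for all $P_i\in\mathrm{Sig}$ ($i\in I$) with $P=\bigcup_iP_i\in\mathrm{Sig}$, $\sim^P=\mathrm{Cg}^{\mathfrak F^P}\big(\bigcup_{i\in I}\sim^{P_i}\cup\,\mathrm{si}(\sim^P)\big)$.
   Context: A logic is a tuple $\mathcal L=\langle F,M,\mathrm{mng},\models\rangle$ with connectives $\mathrm{Cn}$, atomic formulas $P$ (no $p\in P$ a proper term over $P\setminus\{p\}$), formula algebra $\mathfrak F=\mathfrak F(P,\mathrm{Cn})$ (term algebra, universe $F$), class $M$ of models, validity $\models\subseteq M\times F$, and homomorphisms $\mathrm{mng}_{\mathfrak M}$ from $\mathfrak F$ into algebras of type $\mathrm{Cn}$ (equal meanings preserve validity). Tautological congruence $\sim=\bigcap_{\mathfrak M}\ker(\mathrm{mng}_{\mathfrak M})$; $\mathrm{Alg}_m(\mathcal L)=\{\mathrm{mng}_{\mathfrak M}(\mathfrak F)\}$; $\mathrm{si}(\sim)=\{\langle\phi,\psi\rangle:\langle h\phi,h\psi\rangle\in\sim$ for all endomorphisms $h$ of $\mathfrak F\}$. $\mathcal L$ is substitutional if for every $s:P\to F$ and $\mathfrak M\in M$ there is $\mathfrak N\in M$ with $\mathrm{mng}_{\mathfrak N}(p)=\mathrm{mng}_{\mathfrak M}(s(p))$ for all $p\in P$. Reduct, isomorphic copy: $\mathcal L^P$ is a reduct of $\mathcal L^Q$ if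 $P\subseteq Q$, $\mathfrak F^P\le\mathfrak F^Q$, and a surjection $M^Q\to M^P$ preserves meanings and validity on $F^P$; isomorphic copy means there is an isomorphism of formula algebras and a bijection of models preserving meanings and validity. A pre-family of logics is $\mathbf L=\langle\mathcal L^P:P\in\mathrm{Sig}\rangle$ ($\mathrm{Sig}$ a class of sets) with: (1) $P$ is the set of atomic formulas of $\mathcal L^P$; (2) common connectives; (3) $P\subseteq Q$ implies $\mathcal L^P$ a reduct of $\mathcal L^Q$; (5a) for $P\in\mathrm{Sig}$ and any set $H$ there is $P'\in\mathrm{Sig}$ disjoint from $H$ with $\mathcal L^{P'}$ an isomorphic copy of $\mathcal L^P$; (5b) for any nonempty family $P_i\in\mathrm{Sig}$ there are pairwise disjoint $P_i'\in\mathrm{Sig}$ with $\mathcal L^{P_i'}$ isomorphic copies of $\mathcal L^{P_i}$ and $\bigcup P_i'\in\mathrm{Sig}$; (5c) $\mathrm{Sig}$ has a nonempty member. It is substitutional if every $\mathcal L^P$ is. A logic family is a pre-family which also satisfies (4): whenever $P\in\mathrm{Sig}$ is the disjoint union of $P_i\in\mathrm{Sig}$ ($i\in I$), $\sim^P=\bigcap\{\ker h: h$ a homomorphism from $\mathfrak F^P$ into a member of $\mathrm{Alg}_m(\mathcal L^P)$ with $\bigcup_i\sim^{P_i}\subseteq\ker h\}$ (i.e. $\mathfrak F^P/\!\sim^P=\mathfrak{Fr}(\mathrm{Alg}_m(\mathcal L^P),P,\bigcup_i\sim^{P_i})$). Here $\sim^P$ is the tautological congruence of $\mathcal L^P$ and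 $\mathrm{Cg}^{\mathfrak A}(X)$ is the congruence of $\mathfrak A$ generated by $X$. -}

module Defs where

open import Level using (Level)
open import Data.Nat using (ℕ)
open import Data.Vec using (Vec; []; _∷_; map)
open import Data.Vec.Relation.Binary.Pointwise.Inductive using (Pointwise)
open import Data.Product using (Σ; _×_; _,_; proj₁; proj₂)
open import Data.Sum using (_⊎_)
open import Data.Empty using (⊥)
open import Relation.Nullary using (¬_)
open import Relation.Binary.PropositionalEquality using (_≡_; refl)
open import Function.Bundles using (_↔_; Inverse)

record Conn : Set₁ where
  field
    Cn : Set
    ar : Cn → ℕ

-- "Sets" of atoms: small (Set-indexed) injective families of elements of an
-- ambient (large) type Atom of possible atomic formulas.

record SSet (Atom : Set₁) : Set₁ where
  field
    Idx     : Set
    elt     : Idx → Atom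
    elt-inj : ∀ i j → elt i ≡ elt j → i ≡ j

open SSet public

module _ {Atom : Set₁} where

  _∈_ : Atom → SSet Atom → Set₁
  a ∈ P = Σ (Idx P) λ i → elt P i ≡ a

  _⊆_ : SSet Atom → SSet Atom → Set₁
  P ⊆ Q = ∀ a → a ∈ P → a ∈ Q

  Disjoint : SSet Atom → SSet Atom → Set₁
  Disjoint P Q = ∀ a → a ∈ P → a ∈ Q → ⊥

  PairwiseDisjoint : {I : Set} → (I → SSet Atom) → Set₁
  PairwiseDisjoint {I} Ps = ∀ (i j : I) → ¬ (i ≡ j) → Disjoint (Ps i) (Ps j)

  IsUnion : (P : SSet Atom) {I : Set} → (I → SSet Atom) → Set₁
  IsUnion P {I} Ps = ∀ a → (a ∈ P → Σ I λ i → a ∈ Ps i) × (Σ I (λ i → a ∈ Ps i) → a ∈ P)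

  union-⊆ : (P : SSet Atom) {I : Set} (Ps : I → SSet Atom) → IsUnion P Ps → (i : I) → Ps i ⊆ P
  union-⊆ P Ps u i a m = proj₂ (u a) (i , m)

  incl : {P Q : SSet Atom} → P ⊆ Q → Idx P → Idx Q
  incl {P} s i = proj₁ (s (elt P i) (i , refl))

module _ (C : Conn) where
  open Conn C

  data Fm (X : Set) : Set where
    var : X → Fm X
    op  : (c : Cn) → Vec (Fm X) (ar c) → Fm X

  mutual
    ext : {X Y : Set} → (X → Fm Y) → Fm X → Fm Y
    ext s (var x)   = s x
    ext s (op c ts) = op c (extV s ts)

    extV : {X Y : Set} {n : ℕ} → (X → Fm Y) → Vec (Fm X) n → Vec (Fm Y) n
    extV s []       = []
    extV s (t ∷ ts) = ext s t ∷ extV s ts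

  embed : {Atom : Set₁} (P Q : SSet Atom) → P ⊆ Q → Fm (Idx P) → Fm (Idx Q)
  embed P Q s = ext (λ i → var (incl {P = P} {Q = Q} s i))

  Ops : Set₁ → Set₁
  Ops V = (c : Cn) → Vec V (ar c) → V

  IsHom : {X : Set} {V : Set₁} → Ops V → (Fm X → V) → Set₁
  IsHom o h = ∀ c ts → h (op c ts) ≡ o c (map h ts)

  IsEndo : {X : Set} → (Fm X → Fm X) → Set
  IsEndo h = ∀ c ts → h (op c ts) ≡ op c (map h ts)

  -- A logic with atoms X; meanings live in a common universe V

  record Logic (V : Set₁) (X : Set) : Set₂ where
    field
      Mod     : Set₁
      ops     : Mod → Ops V
      mng     : Mod → Fm X → V
      mng-hom : ∀ M → IsHom (ops M) (mng M)
      _⊨_     : Mod → Fm X → Set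
      ⊨-mng   : ∀ M φ ψ → mng M φ ≡ mng M ψ → M ⊨ φ → M ⊨ ψ

  open Logic public

  module _ {V : Set₁} {X : Set} (L : Logic V X) where

    Taut : Fm X → Fm X → Set₁
    Taut φ ψ = ∀ M → mng L M φ ≡ mng L M ψ

    SI : Fm X → Fm X → Set₁
    SI φ ψ = ∀ (h : Fm X → Fm X) → IsEndo h → Taut (h φ) (h ψ)

    HomIntoAlgm : Mod L → (Fm X → V) → Set₁
    HomIntoAlgm M h = IsHom (ops L M) h × (∀ φ → Σ (Fm X) λ ψ → h φ ≡ mng L M ψ)

    Substitutional : Set₁
    Substitutional = ∀ (s : X → Fm X) (M : Mod L) →
      Σ (Mod L) λ N → ∀ φ → mng L N φ ≡ mng L M (ext s φ)

  data Cg {X : Set} (R : Fm X → Fm X → Set₁) : Fm X → Fm X → Set₁ where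
    base  : ∀ {φ ψ} → R φ ψ → Cg R φ ψ
    rfl   : ∀ {φ} → Cg R φ φ
    sym   : ∀ {φ ψ} → Cg R φ ψ → Cg R ψ φ
    trans : ∀ {φ ψ χ} → Cg R φ ψ → Cg R ψ χ → Cg R φ χ
    compat : ∀ c {ts us} → Pointwise (Cg R) ts us → Cg R (op c ts) (op c us)

  record Reduct {V : Set₁} {Atom : Set₁} {P Q : SSet Atom}
                (LP : Logic V (Idx P)) (LQ : Logic V (Idx Q)) (s : P ⊆ Q) : Set₂ where
    field
      f        : Mod LQ → Mod LP
      f-surj   : ∀ N → Σ (Mod LQ) λ M → f M ≡ N
      mng-pres : ∀ M φ → mng LP (f M) φ ≡ mng LQ M (embed P Q s φ)
      val-pres : ∀ M φ → ((LP ⊨ f M) φ → (LQ ⊨ M) (embed P Q s φ))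
                       × ((LQ ⊨ M) (embed P Q s φ) → (LP ⊨ f M) φ)

  record IsoCopy {V : Set₁} {X X' : Set} (L' : Logic V X') (L : Logic V X) : Set₂ where
    field
      fm       : Fm X ↔ Fm X'
      fm-hom   : ∀ c ts → Inverse.to fm (op c ts) ≡ op c (map (Inverse.to fm) ts)
      md       : Mod L ↔ Mod L'
      mng-pres : ∀ M φ → mng L' (Inverse.to md M) (Inverse.to fm φ) ≡ mng L M φ
      val-pres : ∀ M φ → ((L' ⊨ Inverse.to md M) (Inverse.to fm φ) → (L ⊨ M) φ)
                       × ((L ⊨ M) φ → (L' ⊨ Inverse.to md M) (Inverse.to fm φ))

  -- Pre-families of logics (conditions (1),(2) are built in)

  record PreFamily (Atom V : Set₁) : Set₂ where
    field
      Sig : SSet Atom → Set₁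
      L   : (P : SSet Atom) → Logic V (Idx P)
      reduct : ∀ P Q → Sig P → Sig Q → (s : P ⊆ Q) → Reduct {P = P} {Q = Q} (L P) (L Q) s
      copy : ∀ P → Sig P → (H : SSet Atom) →
        Σ (SSet Atom) λ P' → Sig P' × Disjoint P' H × IsoCopy (L P') (L P)
      copyFam : (I : Set) → I → (Ps : I → SSet Atom) → (∀ i → Sig (Ps i)) →
        Σ (I → SSet Atom) λ Ps' → (∀ i → Sig (Ps' i)) × PairwiseDisjoint Ps'
          × (∀ i → IsoCopy (L (Ps' i)) (L (Ps i)))
          × Σ (SSet Atom) (λ U → Sig U × IsUnion U Ps')
      nonempty : Σ (SSet Atom) Sig

  module _ {Atom V : Set₁} (𝐋 : PreFamily Atom V) where
    open PreFamily 𝐋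

    SubstitutionalFamily : Set₁
    SubstitutionalFamily = ∀ P → Sig P → Substitutional (L P)

    UnionTaut : (P : SSet Atom) {I : Set} (Ps : I → SSet Atom) → IsUnion P Ps →
                Fm (Idx P) → Fm (Idx P) → Set₁
    UnionTaut P {I} Ps u φ ψ = Σ I λ i → Σ (Fm (Idx (Ps i))) λ φ' → Σ (Fm (Idx (Ps i))) λ ψ' →
      Taut (L (Ps i)) φ' ψ' × (φ ≡ embed (Ps i) P (union-⊆ P Ps u i) φ') × (ψ ≡ embed (Ps i) P (union-⊆ P Ps u i) ψ')

    Cond4 : Set₁
    Cond4 = ∀ (P : SSet Atom) → Sig P → (I : Set) (Ps : I → SSet Atom) → (∀ i → Sig (Ps i)) →
      (u : IsUnion P Ps) → PairwiseDisjoint Ps → ∀ φ ψ →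
        (Taut (L P) φ ψ →
          ∀ M h → HomIntoAlgm (L P) M h → (∀ φ' ψ' → UnionTaut P Ps u φ' ψ' → h φ' ≡ h ψ') → h φ ≡ h ψ)
      × ((∀ M h → HomIntoAlgm (L P) M h → (∀ φ' ψ' → UnionTaut P Ps u φ' ψ' → h φ' ≡ h ψ') → h φ ≡ h ψ)
          → Taut (L P) φ ψ)

    IsLogicFamily : Set₁
    IsLogicFamily = Cond4

    Cond4b : Set₁
    Cond4b = ∀ (I : Set) (Ps : I → SSet Atom) → (∀ i → Sig (Ps i)) →
      (P : SSet Atom) → Sig P → (u : IsUnion P Ps) → ∀ φ ψ →
        (Taut (L P) φ ψ → Cg (λ φ' ψ' → UnionTaut P Ps u φ' ψ' ⊎ SI (L P) φ' ψ') φ ψ)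
      × (Cg (λ φ' ψ' → UnionTaut P Ps u φ' ψ' ⊎ SI (L P) φ' ψ') φ ψ → Taut (L P) φ ψ)

-- A homomorphism h from the formula algebra into mng_M(F) sends each atom p to the
-- meaning in M of some formula s(p), so it agrees with mng_M ∘ ext s; by
-- substitutionality that is the meaning function of another model N.  Hence h
-- identifies every tautologically equivalent pair: this is the nontrivial half of
-- (4) and, applied to mng_M ∘ e for an endomorphism e, gives ~ ⊆ si(~), the
-- nontrivial half of (4b).  The other halves hold because the kernel of every
-- meaning function is a congruence containing si(~) and each ~^{P_i}.
module Submission where

open import Defs
open import Data.Product using (Σ; _×_; _,_; proj₁; proj₂)
open import Data.Sum using (inj₁; inj₂)
open import Data.Vec using (Vec; []; _∷_; map)
open import Data.Vec.Properties using (map-∘; map-id)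
open import Data.Vec.Relation.Binary.Pointwise.Inductive using (Pointwise; []; _∷_)
open import Relation.Binary.PropositionalEquality as ≡
  using (_≡_; refl; cong; cong₂; module ≡-Reasoning)

module _ (C : Conn) where
  open Conn C

  extV≡map-ext : ∀ {X Y : Set} {n} (s : X → Fm C Y) (ts : Vec (Fm C X) n) →
                 extV C s ts ≡ map (ext C s) ts
  extV≡map-ext s []       = refl
  extV≡map-ext s (t ∷ ts) = cong (ext C s t ∷_) (extV≡map-ext s ts)

  ext-op : ∀ {X Y : Set} (s : X → Fm C Y) c (ts : Vec (Fm C X) (ar c)) →
           ext C s (op c ts) ≡ op c (map (ext C s) ts)
  ext-op s c ts = cong (op c) (extV≡map-ext s ts)

  IsHom-∘ : ∀ {X Y : Set} {V : Set₁} (o : Ops C V) (g : Fm C Y → V) (h : Fm C X → Fm C Y) →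
            (∀ c ts → h (op c ts) ≡ op c (map h ts)) → IsHom C o g →
            IsHom C o (λ φ → g (h φ))
  IsHom-∘ o g h h-op g-hom c ts = begin
    g (h (op c ts))               ≡⟨ cong g (h-op c ts) ⟩
    g (op c (map h ts))           ≡⟨ g-hom c (map h ts) ⟩
    o c (map g (map h ts))        ≡⟨ cong (o c) (≡.sym (map-∘ g h ts)) ⟩
    o c (map (λ φ → g (h φ)) ts)  ∎
    where open ≡-Reasoning

  module _ {X : Set} {V : Set₁} (o : Ops C V) {g h : Fm C X → V}
           (g-hom : IsHom C o g) (h-hom : IsHom C o h)
           (g≡h-on-var : ∀ x → g (var x) ≡ h (var x)) where
    mutual
      IsHom-unique : ∀ φ → g φ ≡ h φ
      IsHom-unique (var x)   = g≡h-on-var x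
      IsHom-unique (op c ts) =
        ≡.trans (g-hom c ts) (≡.trans (cong (o c) (IsHom-uniqueᵛ ts)) (≡.sym (h-hom c ts)))

      IsHom-uniqueᵛ : ∀ {n} (ts : Vec (Fm C X) n) → map g ts ≡ map h ts
      IsHom-uniqueᵛ []       = refl
      IsHom-uniqueᵛ (t ∷ ts) = cong₂ _∷_ (IsHom-unique t) (IsHom-uniqueᵛ ts)

  module _ {X : Set} {V : Set₁} (o : Ops C V) {h : Fm C X → V} (h-hom : IsHom C o h)
           {R : Fm C X → Fm C X → Set₁} (R⊆ker : ∀ {φ ψ} → R φ ψ → h φ ≡ h ψ) where
    mutual
      Cg⊆ker : ∀ {φ ψ} → Cg C R φ ψ → h φ ≡ h ψ
      Cg⊆ker (base r)     = R⊆ker r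
      Cg⊆ker rfl          = refl
      Cg⊆ker (sym p)      = ≡.sym (Cg⊆ker p)
      Cg⊆ker (trans p q)  = ≡.trans (Cg⊆ker p) (Cg⊆ker q)
      Cg⊆ker (compat c {ts} {us} ps) =
        ≡.trans (h-hom c ts) (≡.trans (cong (o c) (Cg⊆kerᵛ ps)) (≡.sym (h-hom c us)))

      Cg⊆kerᵛ : ∀ {n} {ts us : Vec (Fm C X) n} → Pointwise (Cg C R) ts us → map h ts ≡ map h us
      Cg⊆kerᵛ []       = refl
      Cg⊆kerᵛ (p ∷ ps) = cong₂ _∷_ (Cg⊆ker p) (Cg⊆kerᵛ ps)

  module _ {V : Set₁} {X : Set} (L : Logic C V X) where

    substitutional-hom-is-mng : Substitutional C L → ∀ M {h : Fm C X → V} →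
      IsHom C (ops L M) h → (s : X → Fm C X) → (∀ x → h (var x) ≡ mng L M (s x)) →
      Σ (Mod L) λ N → ∀ φ → h φ ≡ mng L N φ
    substitutional-hom-is-mng sub M {h} h-hom s h-var =
      N , λ φ → ≡.trans (h≡mng∘ext φ) (≡.sym (mngN≡ φ))
      where
        N = proj₁ (sub s M)
        mngN≡ = proj₂ (sub s M)
        h≡mng∘ext : ∀ φ → h φ ≡ mng L M (ext C s φ)
        h≡mng∘ext =
          IsHom-unique (ops L M) h-hom
            (IsHom-∘ (ops L M) (mng L M) (ext C s) (ext-op s) (mng-hom L M)) h-var

    Taut⇒hom-≡ : Substitutional C L → ∀ M {h : Fm C X → V} →
      IsHom C (ops L M) h → (s : X → Fm C X) → (∀ x → h (var x) ≡ mng L M (s x)) →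
      ∀ {φ ψ} → Taut C L φ ψ → h φ ≡ h ψ
    Taut⇒hom-≡ sub M h-hom s h-var {φ} {ψ} φ~ψ =
      ≡.trans (h≡mngN φ) (≡.trans (φ~ψ N) (≡.sym (h≡mngN ψ)))
      where
        N = proj₁ (substitutional-hom-is-mng sub M h-hom s h-var)
        h≡mngN = proj₂ (substitutional-hom-is-mng sub M h-hom s h-var)

    Taut⇒SI : Substitutional C L → ∀ {φ ψ} → Taut C L φ ψ → SI C L φ ψ
    Taut⇒SI sub φ~ψ e e-endo M =
      Taut⇒hom-≡ sub M (IsHom-∘ (ops L M) (mng L M) e e-endo (mng-hom L M))
        (λ x → e (var x)) (λ _ → refl) φ~ψ

    SI⇒Taut : ∀ {φ ψ} → SI C L φ ψ → Taut C L φ ψ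
    SI⇒Taut si = si (λ φ → φ) (λ c ts → cong (op c) (≡.sym (map-id ts)))

    Cg⊆Taut : {R : Fm C X → Fm C X → Set₁} → (∀ {φ ψ} → R φ ψ → Taut C L φ ψ) →
              ∀ {φ ψ} → Cg C R φ ψ → Taut C L φ ψ
    Cg⊆Taut R⊆Taut p M = Cg⊆ker (ops L M) (mng-hom L M) (λ r → R⊆Taut r M) p

  module _ {Atom V : Set₁} (𝐋 : PreFamily C Atom V) where
    open PreFamily 𝐋

    UnionTaut⇒Taut : ∀ {P} → Sig P → ∀ {I} {Ps : I → SSet Atom} → (∀ i → Sig (Ps i)) →
      (u : IsUnion P Ps) → ∀ {φ ψ} → UnionTaut C 𝐋 P Ps u φ ψ → Taut C (L P) φ ψ
    UnionTaut⇒Taut {P} sP {Ps = Ps} sPs u (i , φ' , ψ' , φ'~ψ' , refl , refl) M =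
      ≡.trans (≡.sym (mng-pres M φ')) (≡.trans (φ'~ψ' (f M)) (mng-pres M ψ'))
      where open Reduct (reduct (Ps i) P (sPs i) sP (union-⊆ P Ps u i))

    substitutional⇒Cond4 : SubstitutionalFamily C 𝐋 → IsLogicFamily C 𝐋
    substitutional⇒Cond4 sub P sP I Ps sPs u _ φ ψ =
      (λ φ~ψ M h (h-hom , h-img) _ →
         Taut⇒hom-≡ (L P) (sub P sP) M h-hom
           (λ x → proj₁ (h-img (var x))) (λ x → proj₂ (h-img (var x))) φ~ψ)
      , λ h≡ M → h≡ M (mng (L P) M) (mng-hom (L P) M , λ φ → φ , refl)
                   (λ _ _ ut → UnionTaut⇒Taut sP sPs u ut M)

    substitutional⇒Cond4b : SubstitutionalFamily C 𝐋 → Cond4b C 𝐋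
    substitutional⇒Cond4b sub I Ps sPs P sP u φ ψ =
      (λ φ~ψ → base (inj₂ (Taut⇒SI (L P) (sub P sP) φ~ψ)))
      , Cg⊆Taut (L P) λ { (inj₁ ut) → UnionTaut⇒Taut sP sPs u ut
                        ; (inj₂ si) → SI⇒Taut (L P) si }

corollary4p6 : (C : Conn) (Atom V : Set₁) (𝐋 : PreFamily C Atom V) →
    SubstitutionalFamily C 𝐋 → IsLogicFamily C 𝐋 × Cond4b C 𝐋
corollary4p6 C Atom V 𝐋 sub = substitutional⇒Cond4 C 𝐋 sub , substitutional⇒Cond4b C 𝐋 sub
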